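{- Let $\{F_n\}_{n\geq 0}$ be a sequence of positive integers with $F_0=1$, let $V=\bigcup_{s\geq 0}\Phi_s$ with $\Phi_s=\{\langle j,s\rangle : 1\leq j\leq F_s\}$, and let $\Pi=(V,\leq)$ be the cobweb poset, where for $\langle s,t\rangle,\langle u,v\rangle\in V$, $$\langle s,t\rangle\leq\langle u,v\rangle \iff (t<v)\ \vee\ (t=v\ \wedge\ s=u),$$ whose Hasse diagram is the digraph $(V,E)$ with $E=\{(\langle j,p\rangle,\langle q,p+1\rangle) : p\geq 0,\ 1\leq j\leq F_p,\ 1\leq q\leq F_{p+1}\}$. Define two relations $X$ and $Y$ on $V$ by $$\langle s,t\rangle\leq_X\langle u,v\rangle \iff (t<v)\ \vee\ (t=v\ \wedge\ s\leq u),$$ $$\langle s,t\rangle\leq_Y\langle u,v\rangle \iff (t<v)\ \vee\ (t=v\ \wedge\ s\geq u).$$ Then $X$ and $Y$ are linear extensions of $\leq$, and $\leq\,=X\cap Y$ (as sets of ordered pairs). Consequently, the cobweb poset digraph $\Pi$ is an orderable directed acyclic graph (oDAG).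
   Context: A linear extension of a partial order $P$ on a set $A$ is a linear order $L$ on $A$ with $a\leq_P b\Rightarrow a\leq_L b$. The dimension of a partial order $R$ is the least $s$ such that $R$ is the intersection of $s$ linear extensions of $R$. A directed acyclic graph without loops and multiple edges is called orderable (oDAG) if there exists a poset of dimension $2$ whose Hasse diagram coincides with the digraph. -}

module Defs where

open import Level using (0ℓ)
open import Data.Nat using (ℕ; suc; _<_; _≤_; _≥_)
open import Data.Fin using (Fin; toℕ)
open import Data.Product using (Σ; Σ-syntax; _×_; _,_)
open import Data.Sum using (_⊎_)
open import Relation.Nullary using (¬_)
open import Relation.Binary.Core using (Rel; _⇒_)
open import Relation.Binary.Structures using (IsPartialOrder; IsTotalOrder)
open import Relation.Binary.PropositionalEquality using (_≡_)
open import Function.Bundles using (_⇔_)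

LinearExtension : {A : Set} → Rel A 0ℓ → Rel A 0ℓ → Set
LinearExtension P L = IsTotalOrder _≡_ L × (P ⇒ L)

IsIntersection : {A : Set} → Rel A 0ℓ → Rel A 0ℓ → Rel A 0ℓ → Set
IsIntersection R L₁ L₂ = ∀ a b → R a b ⇔ (L₁ a b × L₂ a b)

DimensionAtMost2 : {A : Set} → Rel A 0ℓ → Set₁
DimensionAtMost2 {A} R =
  Σ[ L₁ ∈ Rel A 0ℓ ] Σ[ L₂ ∈ Rel A 0ℓ ]
    (LinearExtension R L₁ × LinearExtension R L₂ × IsIntersection R L₁ L₂)

Covers : {A : Set} → Rel A 0ℓ → Rel A 0ℓ
Covers R a b = ¬ (a ≡ b) × R a b × (∀ c → R a c → R c b → (c ≡ a) ⊎ (c ≡ b))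

IsHasseDiagramOf : {A : Set} → Rel A 0ℓ → Rel A 0ℓ → Set
IsHasseDiagramOf E R = ∀ a b → E a b ⇔ Covers R a b

Orderable : {A : Set} → Rel A 0ℓ → Set₁
Orderable {A} E =
  Σ[ R ∈ Rel A 0ℓ ] (IsPartialOrder _≡_ R × IsHasseDiagramOf E R × DimensionAtMost2 R)

-- Cobweb poset. Vertex ⟨j , t⟩ (level t, index j, 1 ≤ j ≤ F t) is
-- represented as (t , j) with j : Fin (F t) (0-based index).

V : (ℕ → ℕ) → Set
V F = Σ ℕ (λ t → Fin (F t))

_≤Π_ : {F : ℕ → ℕ} → Rel (V F) 0ℓ
(t , s) ≤Π (v , u) = (t < v) ⊎ ((t ≡ v) × (toℕ s ≡ toℕ u))

_≤X_ : {F : ℕ → ℕ} → Rel (V F) 0ℓ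
(t , s) ≤X (v , u) = (t < v) ⊎ ((t ≡ v) × (toℕ s ≤ toℕ u))

_≤Y_ : {F : ℕ → ℕ} → Rel (V F) 0ℓ
(t , s) ≤Y (v , u) = (t < v) ⊎ ((t ≡ v) × (toℕ s ≥ toℕ u))

Edge : {F : ℕ → ℕ} → Rel (V F) 0ℓ
Edge (p , j) (p' , q) = p' ≡ suc p

module Submission where

-- The cobweb poset and the two linear orders X and Y are all instances of
-- one construction: the lexicographic order  Lex O  on the levelled vertex
-- set V F, which compares levels strictly and, inside one level, compares
-- the (0-based) indices by a relation O on ℕ.  Π, X and Y are  Lex _≡_,
-- Lex _≤_  and  Lex _≥_  respectively.
--
-- Since ≡ is a partial order, ≤ and ≥ are total orders and
-- ≡ = ≤ ∩ ≥ on ℕ, this yields that Π is a poset, X and Y are linear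
-- extensions of Π, and Π = X ∩ Y, so Π has dimension at most 2.
-- Separately we show that the covering pairs of Π are exactly the pairs of
-- vertices on consecutive levels; this uses that every level is non-empty.

open import Defs
open import Level using (0ℓ)
open import Data.Nat using (ℕ; suc; _<_; _≤_; _≥_)
open import Data.Nat.Properties
  using (<-trans; <-asym; <-irrefl; <⇒≢; <⇒≱; <-cmp; ≤-refl; ≤-reflexive;
         ≤-antisym; ≤-isTotalOrder; m≤n⇒m<n∨m≡n)
open import Data.Fin using (Fin; toℕ; fromℕ<)
open import Data.Fin.Properties using (toℕ-injective)
open import Data.Product using (_×_; _,_; proj₁; proj₂)
open import Data.Sum using (_⊎_; inj₁; inj₂)
open import Data.Empty using (⊥-elim)
open import Function.Base using (_∘_)
open import Function.Bundles using (_⇔_; mk⇔; Equivalence)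
open import Relation.Binary.Core using (Rel; _⇒_)
open import Relation.Binary.Definitions using (Transitive; Antisymmetric; Total; tri<; tri≈; tri>)
open import Relation.Binary.Structures using (IsPartialOrder; IsTotalOrder)
open import Relation.Binary.PropositionalEquality
  using (_≡_; _≢_; refl; sym; cong; isEquivalence)
import Relation.Binary.PropositionalEquality.Properties as ≡
import Relation.Binary.Construct.Flip.EqAndOrd as Flip

module _ {F : ℕ → ℕ} where

  vertex-≡ : ∀ {t v} {s : Fin (F t)} {u : Fin (F v)} →
             t ≡ v → toℕ s ≡ toℕ u → _≡_ {A = V F} (t , s) (v , u)
  vertex-≡ refl e = cong (_ ,_) (toℕ-injective e)

  level-≢ : {x y : V F} → proj₁ x ≢ proj₁ y → x ≢ y
  level-≢ t≢v = t≢v ∘ cong proj₁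

  Lex : Rel ℕ 0ℓ → Rel (V F) 0ℓ
  Lex O (t , s) (v , u) = (t < v) ⊎ ((t ≡ v) × O (toℕ s) (toℕ u))

  module _ {O : Rel ℕ 0ℓ} where

    lex-trans : Transitive O → Transitive (Lex O)
    lex-trans _     (inj₁ t<v)        (inj₁ v<w)        = inj₁ (<-trans t<v v<w)
    lex-trans _     (inj₁ t<v)        (inj₂ (refl , _)) = inj₁ t<v
    lex-trans _     (inj₂ (refl , _)) (inj₁ v<w)        = inj₁ v<w
    lex-trans trans (inj₂ (refl , p)) (inj₂ (refl , q)) = inj₂ (refl , trans p q)

    lex-antisym : Antisymmetric _≡_ O → Antisymmetric _≡_ (Lex O)
    lex-antisym _       (inj₁ t<v)       (inj₁ v<t)       = ⊥-elim (<-asym t<v v<t)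
    lex-antisym _       (inj₁ t<v)       (inj₂ (v≡t , _)) = ⊥-elim (<-irrefl (sym v≡t) t<v)
    lex-antisym _       (inj₂ (t≡v , _)) (inj₁ v<t)       = ⊥-elim (<-irrefl (sym t≡v) v<t)
    lex-antisym antisym (inj₂ (t≡v , p)) (inj₂ (_ , q))   = vertex-≡ t≡v (antisym p q)

    lex-isPartialOrder : IsPartialOrder _≡_ O → IsPartialOrder _≡_ (Lex O)
    lex-isPartialOrder po = record
      { isPreorder = record
        { isEquivalence = isEquivalence
        ; reflexive     = λ { refl → inj₂ (refl , PO.refl) }
        ; trans         = lex-trans PO.trans
        }
      ; antisym = lex-antisym PO.antisym
      }
      where module PO = IsPartialOrder po

    lex-total : Total O → Total (Lex O)
    lex-total total (t , s) (v , u) with <-cmp t v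
    ... | tri< t<v _ _ = inj₁ (inj₁ t<v)
    ... | tri> _ _ v<t = inj₂ (inj₁ v<t)
    ... | tri≈ _ refl _ with total (toℕ s) (toℕ u)
    ...   | inj₁ p = inj₁ (inj₂ (refl , p))
    ...   | inj₂ q = inj₂ (inj₂ (refl , q))

    lex-isTotalOrder : IsTotalOrder _≡_ O → IsTotalOrder _≡_ (Lex O)
    lex-isTotalOrder O-total = record
      { isPartialOrder = lex-isPartialOrder TO.isPartialOrder
      ; total          = lex-total TO.total
      }
      where module TO = IsTotalOrder O-total

  lex-mono : {O O′ : Rel ℕ 0ℓ} → O ⇒ O′ → Lex O ⇒ Lex O′
  lex-mono _    (inj₁ t<v)       = inj₁ t<v
  lex-mono O⇒O′ (inj₂ (t≡v , p)) = inj₂ (t≡v , O⇒O′ p)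

  lex-linearExtension : {O O′ : Rel ℕ 0ℓ} →
    IsTotalOrder _≡_ O′ → O ⇒ O′ → LinearExtension (Lex O) (Lex O′)
  lex-linearExtension {O} {O′} O′-total O⇒O′ =
    lex-isTotalOrder O′-total , lex-mono {O} {O′} O⇒O′

  lex-intersection : {O O₁ O₂ : Rel ℕ 0ℓ} →
    (∀ a b → O a b ⇔ (O₁ a b × O₂ a b)) →
    IsIntersection (Lex O) (Lex O₁) (Lex O₂)
  lex-intersection {O} {O₁} {O₂} O=O₁∩O₂ x y = mk⇔ split join
    where
    split : Lex O x y → Lex O₁ x y × Lex O₂ x y
    split (inj₁ t<v)       = inj₁ t<v , inj₁ t<v
    split (inj₂ (t≡v , p)) =
      inj₂ (t≡v , proj₁ p₁₂) , inj₂ (t≡v , proj₂ p₁₂)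
      where p₁₂ = Equivalence.to (O=O₁∩O₂ _ _) p

    join : Lex O₁ x y × Lex O₂ x y → Lex O x y
    join (inj₁ t<v , _)                    = inj₁ t<v
    join (inj₂ _ , inj₁ t<v)               = inj₁ t<v
    join (inj₂ (t≡v , p) , inj₂ (_ , q)) =
      inj₂ (t≡v , Equivalence.from (O=O₁∩O₂ _ _) (p , q))

≡⇔≤∩≥ : ∀ (a b : ℕ) → a ≡ b ⇔ (a ≤ b × a ≥ b)
≡⇔≤∩≥ a b = mk⇔ (λ a≡b → ≤-reflexive a≡b , ≤-reflexive (sym a≡b))
                 (λ (a≤b , b≤a) → ≤-antisym a≤b b≤a)

module _ {F : ℕ → ℕ} where

  cobweb-isPartialOrder : IsPartialOrder _≡_ (_≤Π_ {F})
  cobweb-isPartialOrder = lex-isPartialOrder ≡.isPartialOrder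

  X-linearExtension : LinearExtension (_≤Π_ {F}) (_≤X_ {F})
  X-linearExtension = lex-linearExtension ≤-isTotalOrder ≤-reflexive

  Y-linearExtension : LinearExtension (_≤Π_ {F}) (_≤Y_ {F})
  Y-linearExtension =
    lex-linearExtension (Flip.isTotalOrder ≤-isTotalOrder) (≤-reflexive ∘ sym)

  cobweb-=X∩Y : IsIntersection (_≤Π_ {F}) (_≤X_ {F}) (_≤Y_ {F})
  cobweb-=X∩Y = lex-intersection ≡⇔≤∩≥

  cobweb-dimension≤2 : DimensionAtMost2 (_≤Π_ {F})
  cobweb-dimension≤2 =
    _≤X_ , _≤Y_ , X-linearExtension , Y-linearExtension , cobweb-=X∩Y

  -- Every pair of vertices on consecutive levels is a covering pair: a
  -- vertex above ⟨j,p⟩ and below ⟨q,p+1⟩ sits on level p or p+1, and the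
  -- cobweb order identifies it with the endpoint on that level.
  edge⇒covers : ∀ x y → Edge {F} x y → Covers _≤Π_ x y
  edge⇒covers (p , j) (_ , q) refl =
    level-≢ (<⇒≢ ≤-refl) , inj₁ ≤-refl , between
    where
    between : ∀ c → (p , j) ≤Π c → c ≤Π (suc p , q) →
              (c ≡ (p , j)) ⊎ (c ≡ (suc p , q))
    between _ (inj₁ p<r)       (inj₁ r<p+1)      = ⊥-elim (<⇒≱ r<p+1 p<r)
    between _ (inj₁ _)         (inj₂ (r≡ , k≡q)) = inj₂ (vertex-≡ r≡ k≡q)
    between _ (inj₂ (p≡r , j≡k)) _               = inj₁ (sym (vertex-≡ p≡r j≡k))

  -- Conversely a covering pair lies on consecutive levels: it is not on one
  -- level, and if it skipped a level p+1, any vertex of the (non-empty)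
  -- level p+1 would lie strictly between.
  covers⇒edge : (∀ n → 0 < F n) → ∀ x y → Covers _≤Π_ x y → Edge {F} x y
  covers⇒edge _ _ _ (x≢y , inj₂ (t≡v , s≡u) , _) = ⊥-elim (x≢y (vertex-≡ t≡v s≡u))
  covers⇒edge nonempty (p , _) (p′ , _) (_ , inj₁ p<p′ , cover)
    with m≤n⇒m<n∨m≡n p<p′
  ... | inj₂ p+1≡p′ = sym p+1≡p′
  ... | inj₁ p+1<p′ with cover middle (inj₁ ≤-refl) (inj₁ p+1<p′)
    where middle = suc p , fromℕ< (nonempty (suc p))
  ...   | inj₁ middle≡x = ⊥-elim (level-≢ (<⇒≢ ≤-refl) (sym middle≡x))
  ...   | inj₂ middle≡y = ⊥-elim (level-≢ (<⇒≢ p+1<p′) middle≡y)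

  cobweb-hasse : (∀ n → 0 < F n) → IsHasseDiagramOf (Edge {F}) _≤Π_
  cobweb-hasse nonempty x y = mk⇔ (edge⇒covers x y) (covers⇒edge nonempty x y)

theorem4 : (F : ℕ → ℕ) → (∀ n → 0 < F n) → F 0 ≡ 1 →
    IsPartialOrder _≡_ (_≤Π_ {F})
    × IsHasseDiagramOf (Edge {F}) (_≤Π_ {F})
    × LinearExtension (_≤Π_ {F}) (_≤X_ {F})
    × LinearExtension (_≤Π_ {F}) (_≤Y_ {F})
    × IsIntersection (_≤Π_ {F}) (_≤X_ {F}) (_≤Y_ {F})
    × Orderable (Edge {F})
theorem4 F nonempty _ =
  cobweb-isPartialOrder , hasse , X-linearExtension , Y-linearExtension ,
  cobweb-=X∩Y , orderable
  where
  hasse : IsHasseDiagramOf (Edge {F}) _≤Π_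
  hasse = cobweb-hasse nonempty

  orderable : Orderable (Edge {F})
  orderable = _≤Π_ , cobweb-isPartialOrder , hasse , cobweb-dimension≤2
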